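{- Let $\mathcal{L}$ be a fragment as in the context with $\Diamond\in\mathcal{O}$, $\exists\notin\mathcal{O}$ and no action constructors (so the only actions are the relation symbols). Let $(\mathfrak{M},w)$ and $(\mathfrak{N},v)$ be image-finite pointed models over a signature $\Delta$. Then $(\mathfrak{M},w)$ and $(\mathfrak{N},v)$ are $\mathcal{L}$-elementarily equivalent if and only if $(\mathfrak{M},w)\approx_\omega(\mathfrak{N},v)$.
   Context: Hybrid-dynamic propositional logic (HDPL). A signature is $\Delta=((F,P),\mathtt{Prop})$ with $F$ nominals, $P$ binary relation symbols, $\mathtt{Prop}$ propositional symbols; $\Delta[x]$ adds a fresh nominal $x$. A $\Delta$-model $\mathfrak{M}$: a nonempty set $|\mathfrak{M}|$ of states, states $k^{\mathfrak{M}}$ ($k\in F$), relations $\lambda^{\mathfrak{M}}$ ($\lambda\in P$), and $M(w)\subseteq\mathtt{Prop}$ per state; $\mathfrak{M}[x\leftarrow w]$ expands $\mathfrak{M}$ interpreting $x$ as $w$. Actions of HDPL: $\mathfrak{a}::=\lambda\mid\mathfrak{a}\cup\mathfrak{a}\mid\mathfrak{a};\mathfrak{a}\mid\mathfrak{a}^*$. Sentences: $\phi::=p\mid k\mid\bigwedge\Phi\mid\neg\phi\mid\langle\mathfrak{a}\rangle\phi\mid @_k\phi\mid{\downarrow}x.\phi_x\mid\exists x.\phi_x$ ($\Phi$ finite, $\phi_x$ over $\Delta[x]$), with standard satisfaction at pointed models: $\langle\mathfrak{a}\rangle\phi$ holds at $w$ iff $\phi$ holds at some $\mathfrak{a}$-successor;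 $@_k\phi$ iff $\phi$ holds at $k^{\mathfrak{M}}$; ${\downarrow}x.\phi_x$ iff $(\mathfrak{M}[x\leftarrow w],w)\models\phi_x$; $\exists x.\phi_x$ iff $(\mathfrak{M}[x\leftarrow u],w)\models\phi_x$ for some $u$. $\mathcal{L}$ is a fragment obtained by discarding some action constructors and/or some of the constructors $\Diamond$ (possibility), $@$, $\downarrow$, $\exists$ (keeping atoms and Boolean connectives); $\mathcal{O}$ is the set of retained constructors and $\mathcal{A}(\Delta)$ the $\mathcal{L}$-actions. Two pointed $\Delta$-models are $\mathcal{L}$-elementarily equivalent if they satisfy the same $\mathcal{L}$-sentences over $\Delta$. A model is image-finite if $\lambda^{\mathfrak{M}}(u)=\{u'\mid(u,u')\in\lambda^{\mathfrak{M}}\}$ is finite for every state $u$ and every $\lambda\in P$. Countable EF game: on the complete gameboard tree of height $\omega$, where every node labelled $\Delta'$ has exactly one outgoing edge for each of: $1$ (to $\Delta'$); $\downarrow$ (to $\Delta'[x]$, $x$ fresh) if $\downarrow\in\mathcal{O}$; $\exists$ (to $\Delta'[x]$) if $\exists\in\mathcal{O}$; $@_k$ for each nominal $k$ of $\Delta'$ if $@\in\mathcal{O}$; $\langle\mathfrak{a}\rangle$ for each $\mathfrak{a}\in\mathcal{A}(\Delta')$ if $\Diamond\in\mathcal{O}$. Positions: nodes with two pointed models over the node's signature, starting at the root with $(\mathfrak{M},w),(\mathfrak{N},v)$. Eloise loses at a position if the two pointed models disagree on some basic sentence (nominal or propositional symbol of the current signature). Otherwise Abelard picks an edge and one of the pointed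 models, say $(\mathfrak{M},w)$ (symmetric otherwise): $\langle\mathfrak{a}\rangle$: Abelard picks $w_1\in\mathfrak{a}^{\mathfrak{M}}(w)$, Eloise must pick $v_1\in\mathfrak{a}^{\mathfrak{N}}(v)$; $@_k$: new pair $(\mathfrak{M},k^{\mathfrak{M}}),(\mathfrak{N},k^{\mathfrak{N}})$; $\downarrow$: $(\mathfrak{M}[x\leftarrow w],w),(\mathfrak{N}[x\leftarrow v],v)$; $\exists$: Abelard picks $w_1$, Eloise $v_1$, new pair $(\mathfrak{M}[x\leftarrow w_1],w),(\mathfrak{N}[x\leftarrow v_1],v)$; $1$: unchanged. $(\mathfrak{M},w)\approx_\omega(\mathfrak{N},v)$ means Eloise can keep the agreement on basic sentences forever. -}

module Defs where

open import Level using (Level; 0ℓ) renaming (suc to lsuc)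
open import Data.Nat using (ℕ; zero; suc)
open import Data.Bool using (Bool; true; false; T)
open import Data.Maybe using (Maybe; just; nothing)
open import Data.List using (List; []; _∷_)
open import Data.Unit using (⊤)
open import Data.List.Membership.Propositional using (_∈_)
open import Data.Product using (Σ; ∃; _×_; _,_)
open import Relation.Nullary using (¬_)
open import Relation.Binary.PropositionalEquality using (_≡_)
open import Function.Bundles using (_⇔_)

record Sig : Set₁ where
  field
    Nom  : Set
    Rel  : Set
    PropS : Set
open Sig public

-- Δ[x] : Δ extended by one fresh nominal x (represented by `nothing`)
_[x] : Sig → Sig
Δ [x] = record { Nom = Maybe (Nom Δ) ; Rel = Rel Δ ; PropS = PropS Δ }

record Model (Δ : Sig) : Set₁ where
  field
    St    : Set
    inhabitant : St
    nom   : Nom Δ → St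
    rel   : Rel Δ → St → St → Set
    val   : St → PropS Δ → Set
open Model public

expand : {Δ : Sig} (M : Model Δ) → St M → Model (Δ [x])
expand M w = record
  { St = St M ; inhabitant = inhabitant M
  ; nom = λ { (just k) → nom M k ; nothing → w }
  ; rel = rel M ; val = val M }

ImageFinite : {Δ : Sig} → Model Δ → Set
ImageFinite {Δ} M =
  (u : St M) (r : Rel Δ) → ∃ λ (xs : List (St M)) → ∀ u′ → (rel M r u u′ ⇔ (u′ ∈ xs))

-- The fragment 𝓛: ◇ ∈ 𝓞, ∃ ∉ 𝓞, no action constructors (actions are
-- exactly the relation symbols).  Whether @ and ↓ are retained is
-- recorded by the two booleans `hasAt`, `hasDown`.

record Frag : Set where
  constructor frag
  field
    hasAt   : Bool
    hasDown : Bool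
open Frag public

data Form (O : Frag) : Sig → Set₁ where
  prop : {Δ : Sig} → PropS Δ → Form O Δ
  nomi : {Δ : Sig} → Nom Δ → Form O Δ
  ⋀    : {Δ : Sig} → List (Form O Δ) → Form O Δ
  ¬′   : {Δ : Sig} → Form O Δ → Form O Δ
  ⟨_⟩_ : {Δ : Sig} → Rel Δ → Form O Δ → Form O Δ
  at   : {Δ : Sig} → T (hasAt O) → Nom Δ → Form O Δ → Form O Δ
  down : {Δ : Sig} → T (hasDown O) → Form O (Δ [x]) → Form O Δ

mutual
  Sat : {O : Frag} {Δ : Sig} (M : Model Δ) → St M → Form O Δ → Set
  Sat M w (prop p)   = val M w p
  Sat M w (nomi k)   = nom M k ≡ w
  Sat M w (⋀ Φ)      = SatAll M w Φ
  Sat M w (¬′ φ)     = ¬ Sat M w φ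
  Sat M w (⟨ r ⟩ φ)  = ∃ λ w₁ → rel M r w w₁ × Sat M w₁ φ
  Sat M w (at _ k φ) = Sat M (nom M k) φ
  Sat M w (down _ φ) = Sat (expand M w) w φ

  SatAll : {O : Frag} {Δ : Sig} (M : Model Δ) → St M → List (Form O Δ) → Set
  SatAll M w []       = ⊤
  SatAll M w (φ ∷ Φ) = Sat M w φ × SatAll M w Φ

ElemEquiv : (O : Frag) {Δ : Sig} (M : Model Δ) → St M → (N : Model Δ) → St N → Set₁
ElemEquiv O {Δ} M w N v = (φ : Form O Δ) → Sat M w φ ⇔ Sat N v φ

-- The countable Ehrenfeucht–Fraïssé game.  (𝔐,w) ≈ω (𝔑,v) holds iff
-- Eloise can keep agreement on basic sentences forever.  Since the
-- subtree of the gameboard below a node labelled Δ′ is determined by Δ′,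
-- and every node reachable from the root Δ is labelled Δ[x]…[x] (n fresh
-- nominals, one for each ↓-edge taken), a winning strategy for Eloise
-- is (equivalently to the greatest fixed point) a family Z of "safe"
-- positions indexed by the node label, containing the initial position,
-- such that in every safe position the two pointed models agree on basic
-- sentences and every move of Abelard can be answered by Eloise so that
-- the next position is again safe.

_⁺_ : Sig → ℕ → Sig
Δ ⁺ zero  = Δ
Δ ⁺ suc n = (Δ ⁺ n) [x]

BasicAgree : {Δ : Sig} (M : Model Δ) → St M → (N : Model Δ) → St N → Set
BasicAgree {Δ} M w N v =
  ((p : PropS Δ) → val M w p ⇔ val N v p) ×
  ((k : Nom Δ) → (nom M k ≡ w) ⇔ (nom N k ≡ v))

Positions : Sig → Set₂
Positions Δ = (n : ℕ) (M : Model (Δ ⁺ n)) → St M → (N : Model (Δ ⁺ n)) → St N → Set₁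

-- Z is closed under Eloise's strategy (edge 1 keeps the position, so it
-- imposes no condition)
record IsWinning (O : Frag) (Δ : Sig) (Z : Positions Δ) : Set₁ where
  field
    agree  : ∀ n M w N v → Z n M w N v → BasicAgree M w N v
    diaˡ   : ∀ n M w N v → Z n M w N v →
             (r : Rel (Δ ⁺ n)) (w₁ : St M) → rel M r w w₁ →
             ∃ λ (v₁ : St N) → rel N r v v₁ × Z n M w₁ N v₁
    diaʳ   : ∀ n M w N v → Z n M w N v →
             (r : Rel (Δ ⁺ n)) (v₁ : St N) → rel N r v v₁ →
             ∃ λ (w₁ : St M) → rel M r w w₁ × Z n M w₁ N v₁
    atMove : ∀ n M w N v → Z n M w N v → T (hasAt O) →
             (k : Nom (Δ ⁺ n)) → Z n M (nom M k) N (nom N k)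
    downMove : ∀ n M w N v → Z n M w N v → T (hasDown O) →
               Z (suc n) (expand M w) w (expand N v) v

Game : (O : Frag) (Δ : Sig) (M : Model Δ) → St M → (N : Model Δ) → St N → Set₂
Game O Δ M w N v =
  Σ (Positions Δ) λ Z → IsWinning O Δ Z × Z zero M w N v

-- Soundness of the game is an induction on formulas along Eloise's strategy.
-- Conversely, elementary equivalence itself (between image-finite models) is a
-- winning strategy: @ and ↓ moves preserve it because @ₖφ and ↓x.φ are again
-- sentences, and a ⟨λ⟩ move is answered by the Hennessy–Milner argument — if no
-- λ-successor of v were equivalent to the chosen successor w₁ of w, a finite
-- conjunction would separate w₁ from all of them, and ⟨λ⟩ of that conjunction
-- would hold at w but not at v.
module Submission where

open import Defs
open import Level using (0ℓ; lift; lower) renaming (suc to lsuc)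
open import Axiom.ExcludedMiddle using (ExcludedMiddle)
open import Axiom.DoubleNegationElimination using (em⇒dne)
open import Function.Base using (_∘_)
open import Function.Bundles using (_⇔_; mk⇔; Equivalence)
open import Function.Properties.Equivalence using () renaming (sym to ⇔-sym)
open import Data.List using (List; []; _∷_)
open import Data.List.Membership.Propositional using (_∈_)
open import Data.List.Relation.Unary.Any using (here; there)
open import Data.Product using (∃; _×_; _,_; proj₁; proj₂)
open import Data.Product.Function.NonDependent.Propositional using (_×-⇔_)
open import Data.Unit using (tt)
open import Relation.Nullary using (¬_)
open import Relation.Binary.PropositionalEquality using (refl)

open Equivalence using (to; from)

module _ {O : Frag} {Δ : Sig} {Z : Positions Δ} (winning : IsWinning O Δ Z) where
  open IsWinning winning

  mutual
    safe⇒sat-⇔ : ∀ {n} {M N : Model (Δ ⁺ n)} {w v} → Z n M w N v →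
                 (φ : Form O (Δ ⁺ n)) → Sat M w φ ⇔ Sat N v φ
    safe⇒sat-⇔ {n} {M} {N} {w} {v} z (prop p) = proj₁ (agree n M w N v z) p
    safe⇒sat-⇔ {n} {M} {N} {w} {v} z (nomi k) = proj₂ (agree n M w N v z) k
    safe⇒sat-⇔ z (⋀ Φ) = safe⇒satAll-⇔ z Φ
    safe⇒sat-⇔ z (¬′ φ) =
      mk⇔ (λ ¬s t → ¬s (from (safe⇒sat-⇔ z φ) t)) (λ ¬t s → ¬t (to (safe⇒sat-⇔ z φ) s))
    safe⇒sat-⇔ {n} {M} {N} {w} {v} z (⟨ r ⟩ φ) = mk⇔
      (λ (w₁ , rw , s) → let v₁ , rv , z₁ = diaˡ n M w N v z r w₁ rw
                         in v₁ , rv , to (safe⇒sat-⇔ z₁ φ) s)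
      (λ (v₁ , rv , t) → let w₁ , rw , z₁ = diaʳ n M w N v z r v₁ rv
                         in w₁ , rw , from (safe⇒sat-⇔ z₁ φ) t)
    safe⇒sat-⇔ {n} {M} {N} {w} {v} z (at h k φ) = safe⇒sat-⇔ (atMove n M w N v z h k) φ
    safe⇒sat-⇔ {n} {M} {N} {w} {v} z (down h φ) = safe⇒sat-⇔ (downMove n M w N v z h) φ

    safe⇒satAll-⇔ : ∀ {n} {M N : Model (Δ ⁺ n)} {w v} → Z n M w N v →
                    (Φ : List (Form O (Δ ⁺ n))) → SatAll M w Φ ⇔ SatAll N v Φ
    safe⇒satAll-⇔ z []      = mk⇔ (λ _ → tt) (λ _ → tt)
    safe⇒satAll-⇔ z (φ ∷ Φ) = safe⇒sat-⇔ z φ ×-⇔ safe⇒satAll-⇔ z Φ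

module _ {O : Frag} {Δ : Sig} where

  Distinguishable : (M : Model Δ) → St M → (N : Model Δ) → St N → Set₁
  Distinguishable M w N v = ∃ λ (φ : Form O Δ) → Sat M w φ × ¬ Sat N v φ

  ElemEquiv-sym : {M N : Model Δ} {w : St M} {v : St N} →
                  ElemEquiv O M w N v → ElemEquiv O N v M w
  ElemEquiv-sym ee φ = ⇔-sym (ee φ)

  separateFromAll : (M : Model Δ) (w : St M) (N : Model Δ) (us : List (St N)) →
                    (∀ {u} → u ∈ us → Distinguishable M w N u) →
                    ∃ λ (φ : Form O Δ) → Sat M w φ × (∀ {u} → u ∈ us → ¬ Sat N u φ)
  separateFromAll M w N []       _    = ⋀ [] , tt , λ ()
  separateFromAll M w N (u ∷ us) dist =
    let φ , sφ , ¬φ = dist (here refl)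
        ψ , sψ , ¬ψ = separateFromAll M w N us (dist ∘ there)
    in ⋀ (φ ∷ ψ ∷ []) , (sφ , sψ , tt) , λ where
         (here refl)  (s , _)     → ¬φ s
         (there u∈us) (_ , s , _) → ¬ψ u∈us s

module _ (em : ExcludedMiddle (lsuc 0ℓ)) {O : Frag} {Δ : Sig} where

  private
    dne₁ : {A : Set₁} → ¬ ¬ A → A
    dne₁ = em⇒dne em

    dne : {A : Set} → ¬ ¬ A → A
    dne ¬¬a = lower (dne₁ λ ¬a → ¬¬a (¬a ∘ lift))

  ¬ElemEquiv⇒distinguishable : {M N : Model Δ} {w : St M} {v : St N} →
                               ¬ ElemEquiv O M w N v → Distinguishable M w N v
  ¬ElemEquiv⇒distinguishable ¬ee = dne₁ λ ¬dist → ¬ee λ φ → mk⇔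
    (λ s → dne λ ¬t → ¬dist (φ , s , ¬t))
    (λ t → dne λ ¬s → ¬dist (¬′ φ , ¬s , λ ¬t → ¬t t))

  elemEquiv-zig : {M N : Model Δ} {w w₁ : St M} {v : St N} {r : Rel Δ} →
                  ImageFinite N → ElemEquiv O M w N v → rel M r w w₁ →
                  ∃ λ v₁ → rel N r v v₁ × ElemEquiv O M w₁ N v₁
  elemEquiv-zig {M} {N} {w} {w₁} {v} {r} finN ee rw = dne₁ λ ¬zig →
    let succs , ∈succs = finN v r
        φ , sφ , ¬φ    = separateFromAll M w₁ N succs λ {u} u∈succs →
                           ¬ElemEquiv⇒distinguishable λ ee₁ →
                             ¬zig (u , from (∈succs u) u∈succs , ee₁)
        v₁ , rv , tφ   = to (ee (⟨ r ⟩ φ)) (w₁ , rw , sφ)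
    in ¬φ (to (∈succs v₁) rv) tφ

module _ (em : ExcludedMiddle (lsuc 0ℓ)) (O : Frag) (Δ : Sig) where

  -- Expansions keep the states and relations, so image-finiteness is
  -- inherited by ↓-moves definitionally.
  ImageFiniteElemEquiv : Positions Δ
  ImageFiniteElemEquiv n M w N v = ImageFinite M × ImageFinite N × ElemEquiv O M w N v

  imageFiniteElemEquiv-isWinning : IsWinning O Δ ImageFiniteElemEquiv
  imageFiniteElemEquiv-isWinning = record
    { agree    = λ _ _ _ _ _ (_ , _ , ee) → (λ p → ee (prop p)) , (λ k → ee (nomi k))
    ; diaˡ     = λ _ _ _ _ _ (finM , finN , ee) r w₁ rw →
        let v₁ , rv , ee₁ = elemEquiv-zig em finN ee rw
        in v₁ , rv , finM , finN , ee₁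
    ; diaʳ     = λ _ _ _ _ _ (finM , finN , ee) r v₁ rv →
        let w₁ , rw , ee₁ = elemEquiv-zig em finM (ElemEquiv-sym ee) rv
        in w₁ , rw , finM , finN , ElemEquiv-sym ee₁
    ; atMove   = λ _ _ _ _ _ (finM , finN , ee) h k → finM , finN , λ φ → ee (at h k φ)
    ; downMove = λ _ _ _ _ _ (finM , finN , ee) h → finM , finN , λ φ → ee (down h φ)
    }

mainTheorem7 : ExcludedMiddle (lsuc 0ℓ) →
    (O : Frag) (Δ : Sig) (M : Model Δ) (w : St M) (N : Model Δ) (v : St N) →
    ImageFinite M → ImageFinite N →
    ElemEquiv O M w N v ⇔ Game O Δ M w N v
mainTheorem7 em O Δ M w N v finM finN = mk⇔
  (λ ee → ImageFiniteElemEquiv em O Δ , imageFiniteElemEquiv-isWinning em O Δ , finM , finN , ee)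
  (λ (Z , winning , z₀) → safe⇒sat-⇔ winning z₀)
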